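{- If $\langle X,\rho,Y\rangle$ is a 2space, then $\langle X^*,+,\cdot\rangle$ is a distributive bisemilattice, where for $Z,W\in X^*$ we set $Z\cdot W=Z\cap W$ and $Z+W=\rho^{ -1}(\rho(Z)\cup\rho(W))$.
   Context: **Bisemilattices.** A distributive bisemilattice is an algebra with two binary operations, each idempotent, commutative and associative, each distributing over the other. **Fspaces.** An Fspace is a Stone space $X$ with a partial order $\le$ such that: (1) every subset has a greatest lower bound; (2) there is a clopen subbasis $\{X_i\}_{i\in I}\cup\{\overline X_i\}_{i\in I}$, where $X_i=\{x:x_i\le x\}$ for points $x_i$ and $\overline X_i=X\setminus X_i$; (3) every $x$ is the least upper bound of $\{x_i:x_i\le x\}$; (4) $X^*=\{X_i\}$ is closed under finite intersections. Put $\overline X^*=\{\overline X_i\}$. **2spaces.** A 2space $\langle X,\rho,Y\rangle$ consists of: - Fspaces $X,Y$ with subbases $\{X_a\}_{a\in A}\cup\{\overline X_a\}_{a\in A}$ and $\{Y_a\}_{a\in A}\cup\{\overline Y_a\}_{a\in A}$ over a common index set $A$; - a bijection $\rho:X^*\to\overline Y^*$ with $\rho(X_a)=\overline Y_a$, satisfying $P\cap\rho^{ -1}(\rho(Q)\cup\rho(R))=\rho^{ -1}(\rho(P\cap Q)\cup\rho(P\cap R))$ for all $P,Q,R\in X^*$, and $P\cup\rho(\rho^{ -1}(Q)\cap\rho^{ -1}(R))=\rho(\rho^{ -1}(P\cup Q)\cap\rho^{ -1}(P\cup R))$ for all $P,Q,R\in\overline Y^*$. -}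

module Defs where

open import Level using (0ℓ)
open import Data.Product using (Σ; ∃; _×_; _,_)
open import Data.Sum using (_⊎_; inj₁; inj₂)
open import Data.List using (List)
open import Data.Unit using (⊤)
open import Data.Empty using (⊥)
open import Data.List.Relation.Unary.All using (All)
open import Data.List.Relation.Unary.Any using (Any)
open import Relation.Nullary using (¬_)
open import Relation.Unary using (Pred; _≐_; _∩_; _∪_; ∁; _⊆_)
open import Relation.Binary using (Rel; IsPartialOrder)
open import Relation.Binary.PropositionalEquality using (_≡_; _≢_)
open import Algebra.Core using (Op₂)
open import Algebra.Definitions using (_DistributesOver_)
open import Algebra.Lattice.Structures using (IsSemilattice)

record Topology (X : Set) : Set₁ where
  field
    IsOpen     : Pred X 0ℓ → Set
    open-resp  : ∀ {U V} → U ≐ V → IsOpen U → IsOpen V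
    open-whole : IsOpen (λ _ → ⊤)
    open-∩     : ∀ {U V} → IsOpen U → IsOpen V → IsOpen (U ∩ V)
    open-⋃     : (I : Set) (U : I → Pred X 0ℓ) → (∀ i → IsOpen (U i))
                 → IsOpen (λ x → ∃ λ i → U i x)

module _ {X : Set} (τ : Topology X) where
  open Topology τ

  IsCompact : Set₁
  IsCompact = (I : Set) (U : I → Pred X 0ℓ) → (∀ i → IsOpen (U i))
              → (∀ x → ∃ λ i → U i x)
              → ∃ λ (is : List I) → ∀ x → Any (λ i → U i x) is

  IsHausdorff : Set₁
  IsHausdorff = ∀ x y → x ≢ y →
    Σ (Pred X 0ℓ) λ U → Σ (Pred X 0ℓ) λ V →
      IsOpen U × IsOpen V × U x × V y × (∀ z → U z → V z → ⊥)

  IsTotallyDisconnected : Set₁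
  IsTotallyDisconnected = ∀ (S : Pred X 0ℓ) x y → S x → S y → x ≢ y →
    Σ (Pred X 0ℓ) λ U → Σ (Pred X 0ℓ) λ V →
      IsOpen U × IsOpen V × S ⊆ (U ∪ V) × (∀ z → S z → U z → ¬ V z)
      × U x × V y

  record IsStone : Set₁ where
    field
      compact  : IsCompact
      hausdorff : IsHausdorff
      totDisc  : IsTotallyDisconnected

subbasic : {X A : Set} → Rel X 0ℓ → (A → X) → A ⊎ A → Pred X 0ℓ
subbasic _≤_ pt (inj₁ a) x = pt a ≤ x
subbasic _≤_ pt (inj₂ a) x = ¬ (pt a ≤ x)

record Fspace (A : Set) : Set₁ where
  field
    Carrier        : Set
    topology       : Topology Carrier
    isStone        : IsStone topology
    _≤_            : Rel Carrier 0ℓ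
    isPartialOrder : IsPartialOrder _≡_ _≤_
    glb : ∀ (S : Pred Carrier 0ℓ) → ∃ λ g →
            (∀ s → S s → g ≤ s) × (∀ l → (∀ s → S s → l ≤ s) → l ≤ g)
    pt  : A → Carrier
    subbasic-open : ∀ s → Topology.IsOpen topology (subbasic _≤_ pt s)
    subbasis : ∀ U → Topology.IsOpen topology U → ∀ x → U x →
                 ∃ λ (ss : List (A ⊎ A)) →
                   All (λ s → subbasic _≤_ pt s x) ss ×
                   (∀ y → All (λ s → subbasic _≤_ pt s y) ss → U y)
    lub : ∀ x → (∀ a → pt a ≤ x → pt a ≤ x) ×
                (∀ u → (∀ a → pt a ≤ x → pt a ≤ u) → x ≤ u)
    closed-∩ : ∀ a b → ∃ λ c →
                 (λ x → pt c ≤ x) ≐ ((λ x → pt a ≤ x) ∩ (λ x → pt b ≤ x))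

  Sub : A → Pred Carrier 0ℓ
  Sub a x = pt a ≤ x

  coSub : A → Pred Carrier 0ℓ
  coSub a = ∁ (Sub a)

-- 2spaces.  ρ : X* → Ȳ* is given by ρ(X_a) = Ȳ_a; ρ being a well-defined
-- bijection means X_a = X_b ⇔ Ȳ_a = Ȳ_b (surjectivity is automatic).
-- ρ⁻¹(S) for S ∈ Ȳ* is X_c for any c with Ȳ_c = S.

record TwoSpace (A : Set) : Set₁ where
  field
    X Y : Fspace A
  module X = Fspace X
  module Y = Fspace Y
  field
    ρ-wd  : ∀ a b → X.Sub a ≐ X.Sub b → Y.coSub a ≐ Y.coSub b
    ρ-inj : ∀ a b → Y.coSub a ≐ Y.coSub b → X.Sub a ≐ X.Sub b
    -- P ∩ ρ⁻¹(ρQ ∪ ρR) = ρ⁻¹(ρ(P∩Q) ∪ ρ(P∩R)),  P = X_p, Q = X_q, R = X_r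
    dist₁ : ∀ p q r c d e f →
      Y.coSub c ≐ (Y.coSub q ∪ Y.coSub r) →
      X.Sub d ≐ (X.Sub p ∩ X.Sub q) →
      X.Sub e ≐ (X.Sub p ∩ X.Sub r) →
      Y.coSub f ≐ (Y.coSub d ∪ Y.coSub e) →
      (X.Sub p ∩ X.Sub c) ≐ X.Sub f
    -- P ∪ ρ(ρ⁻¹Q ∩ ρ⁻¹R) = ρ(ρ⁻¹(P∪Q) ∩ ρ⁻¹(P∪R)),  P = Ȳ_p, Q = Ȳ_q, R = Ȳ_r
    dist₂ : ∀ p q r d c₁ c₂ e →
      X.Sub d ≐ (X.Sub q ∩ X.Sub r) →
      Y.coSub c₁ ≐ (Y.coSub p ∪ Y.coSub q) →
      Y.coSub c₂ ≐ (Y.coSub p ∪ Y.coSub r) →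
      X.Sub e ≐ (X.Sub c₁ ∩ X.Sub c₂) →
      (Y.coSub p ∪ Y.coSub d) ≐ Y.coSub e

  -- equality of elements of X* (elements represented by indices)
  _≈*_ : Rel A _
  a ≈* b = X.Sub a ≐ X.Sub b

  -- specifications of the operations on X*
  -- Z + W = ρ⁻¹(ρ Z ∪ ρ W), i.e. ρ(X_{a+b}) = Ȳ_a ∪ Ȳ_b
  PlusSpec : Op₂ A → Set
  PlusSpec _+_ = ∀ a b → Y.coSub (a + b) ≐ (Y.coSub a ∪ Y.coSub b)

  TimesSpec : Op₂ A → Set
  TimesSpec _·_ = ∀ a b → X.Sub (a · b) ≐ (X.Sub a ∩ X.Sub b)

record IsDistributiveBisemilattice {A : Set} {ℓ} (_≈_ : Rel A ℓ)
         (_+_ _·_ : Op₂ A) : Set ℓ where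
  field
    +-isSemilattice : IsSemilattice _≈_ _+_
    ·-isSemilattice : IsSemilattice _≈_ _·_
    +-distrib-· : _DistributesOver_ _≈_ _+_ _·_
    ·-distrib-+ : _DistributesOver_ _≈_ _·_ _+_

module Submission where

-- Both operations are faithful images of set operations:
--   * a ↦ X_a sends  ·  to  ∩  (this is the definition of  ·), and
--   * a ↦ ρ(X_a) = Ȳ_a sends  +  to  ∪  (this is the definition of  +),
-- and both maps reflect the identification of indices (the second one
-- because ρ is a bijection).  So each operation is a magma monomorphism
-- into a semilattice of predicates, which makes it a semilattice itself.
-- The two left distributive laws are precisely the two axioms dist₁ and
-- dist₂ of a 2space; commutativity then gives the right-hand ones.
-- Finally, the operations exist: · because X* is closed under ∩, and +
-- because Y* is closed under ∩ and, classically, Ȳ_c = Ȳ_a ∪ Ȳ_b when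
-- Y_c = Y_a ∩ Y_b (De Morgan; this is where excluded middle is used).

open import Defs
open import Level using (0ℓ)
open import Data.Product using (Σ; _×_; _,_; proj₁; proj₂)
open import Data.Sum using (inj₁; inj₂)
open import Algebra.Core using (Op₂)
open import Algebra.Bundles using (RawMagma)
open import Algebra.Definitions using (_DistributesOverˡ_)
open import Algebra.Morphism.Structures using (module MagmaMorphisms)
import Algebra.Morphism.MagmaMonomorphism as MagmaMonomorphism
import Algebra.Consequences.Setoid as SetoidConsequences
open import Algebra.Lattice.Structures using (IsSemilattice)
open import Algebra.Structures using (module IsCommutativeBand)
open import Axiom.ExcludedMiddle using (ExcludedMiddle)
open import Relation.Nullary using (yes; no)
open import Relation.Unary using (Pred; _≐_; _∩_; _∪_; ∁)
open import Relation.Unary.Properties using (≐-trans)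
open import Relation.Unary.Algebra using (∩-isSemilattice; ∪-isSemilattice)
open import Relation.Binary.Bundles using (Setoid)
open import Relation.Unary.Relation.Binary.Equality using (≐-setoid)
import Relation.Binary.Construct.On as On

open MagmaMorphisms using (IsMagmaMonomorphism)

semilattice-from-monomorphism :
  ∀ {a b ℓ₁ ℓ₂} {M₁ : RawMagma a ℓ₁} {M₂ : RawMagma b ℓ₂}
    {⟦_⟧ : RawMagma.Carrier M₁ → RawMagma.Carrier M₂} →
  IsMagmaMonomorphism M₁ M₂ ⟦_⟧ →
  IsSemilattice (RawMagma._≈_ M₂) (RawMagma._∙_ M₂) →
  IsSemilattice (RawMagma._≈_ M₁) (RawMagma._∙_ M₁)
semilattice-from-monomorphism mono isSemilattice = record
  { isBand = Mono.isBand S.isBand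
  ; comm   = Mono.comm S.isMagma S.comm
  }
  where
  module Mono = MagmaMonomorphism mono
  module S = IsCommutativeBand isSemilattice

∁-∩-≐-∪-∁ : ExcludedMiddle 0ℓ → {Z : Set} {P Q : Pred Z 0ℓ} →
            ∁ (P ∩ Q) ≐ (∁ P ∪ ∁ Q)
∁-∩-≐-∪-∁ em {P = P} {Q} = ⊆-union , ⊆-complement
  where
  ⊆-union : ∀ {z} → ∁ (P ∩ Q) z → (∁ P ∪ ∁ Q) z
  ⊆-union {z} ¬pq with em {P z}
  ... | no  ¬p = inj₁ ¬p
  ... | yes p  = inj₂ (λ q → ¬pq (p , q))
  ⊆-complement : ∀ {z} → (∁ P ∪ ∁ Q) z → ∁ (P ∩ Q) z
  ⊆-complement (inj₁ ¬p) (p , _) = ¬p p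
  ⊆-complement (inj₂ ¬q) (_ , q) = ¬q q

∁-cong : {Z : Set} {P Q : Pred Z 0ℓ} → P ≐ Q → ∁ P ≐ ∁ Q
∁-cong (P⊆Q , Q⊆P) = (λ ¬p q → ¬p (Q⊆P q)) , (λ ¬q p → ¬q (P⊆Q p))

module _ {A : Set} (T : TwoSpace A) where
  open TwoSpace T

  X*-setoid : Setoid 0ℓ 0ℓ
  X*-setoid = On.setoid (≐-setoid X.Carrier 0ℓ) X.Sub

  ·-monomorphism : (_·_ : Op₂ A) → TimesSpec _·_ →
    IsMagmaMonomorphism (record { _≈_ = _≈*_ ; _∙_ = _·_ })
                        (record { _≈_ = _≐_ ; _∙_ = _∩_ }) X.Sub
  ·-monomorphism _·_ times = record
    { isMagmaHomomorphism = record
      { isRelHomomorphism = record { cong = λ X_a≐X_b → X_a≐X_b }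
      ; homo = times
      }
    ; injective = λ X_a≐X_b → X_a≐X_b
    }

  +-monomorphism : (_+_ : Op₂ A) → PlusSpec _+_ →
    IsMagmaMonomorphism (record { _≈_ = _≈*_ ; _∙_ = _+_ })
                        (record { _≈_ = _≐_ ; _∙_ = _∪_ }) Y.coSub
  +-monomorphism _+_ plus = record
    { isMagmaHomomorphism = record
      { isRelHomomorphism = record { cong = ρ-wd _ _ }
      ; homo = plus
      }
    ; injective = ρ-inj _ _
    }

  times-exists : Σ (Op₂ A) TimesSpec
  times-exists = (λ a b → proj₁ (X.closed-∩ a b)) ,
                 (λ a b → proj₂ (X.closed-∩ a b))

  -- The join exists: take Y_c = Y_a ∩ Y_b; then Ȳ_c = Ȳ_a ∪ Ȳ_b.
  plus-exists : ExcludedMiddle 0ℓ → Σ (Op₂ A) PlusSpec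
  plus-exists em = (λ a b → proj₁ (Y.closed-∩ a b)) ,
                   (λ a b → ≐-trans (∁-cong (proj₂ (Y.closed-∩ a b)))
                                    (∁-∩-≐-∪-∁ em))

  ·-distribˡ-+ : (_+_ _·_ : Op₂ A) → PlusSpec _+_ → TimesSpec _·_ →
                 _DistributesOverˡ_ _≈*_ _·_ _+_
  ·-distribˡ-+ _+_ _·_ plus times p q r =
    ≐-trans (times p (q + r))
            (dist₁ p q r (q + r) (p · q) (p · r) ((p · q) + (p · r))
                   (plus q r) (times p q) (times p r) (plus (p · q) (p · r)))

  +-distribˡ-· : (_+_ _·_ : Op₂ A) → PlusSpec _+_ → TimesSpec _·_ →
                 _DistributesOverˡ_ _≈*_ _+_ _·_
  +-distribˡ-· _+_ _·_ plus times p q r = ρ-inj _ _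
    (≐-trans (plus p (q · r))
             (dist₂ p q r (q · r) (p + q) (p + r) ((p + q) · (p + r))
                    (times q r) (plus p q) (plus p r) (times (p + q) (p + r))))

  distributive-bisemilattice : (_+_ _·_ : Op₂ A) → PlusSpec _+_ → TimesSpec _·_ →
    IsDistributiveBisemilattice _≈*_ _+_ _·_
  distributive-bisemilattice _+_ _·_ plus times = record
    { +-isSemilattice = +-semilattice
    ; ·-isSemilattice = ·-semilattice
    ; +-distrib-· = comm∧distrˡ⇒distr (·.∙-cong) (+.comm)
                      (+-distribˡ-· _+_ _·_ plus times)
    ; ·-distrib-+ = comm∧distrˡ⇒distr (+.∙-cong) (·.comm)
                      (·-distribˡ-+ _+_ _·_ plus times)
    }
    where
    open SetoidConsequences X*-setoid using (comm∧distrˡ⇒distr)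
    +-semilattice : IsSemilattice _≈*_ _+_
    +-semilattice = semilattice-from-monomorphism (+-monomorphism _+_ plus)
                                                  (∪-isSemilattice Y.Carrier 0ℓ)
    ·-semilattice : IsSemilattice _≈*_ _·_
    ·-semilattice = semilattice-from-monomorphism (·-monomorphism _·_ times)
                                                  (∩-isSemilattice X.Carrier 0ℓ)
    module + = IsCommutativeBand +-semilattice
    module · = IsCommutativeBand ·-semilattice

lemma6p2 : ExcludedMiddle 0ℓ → {A : Set} (T : TwoSpace A) →
    Σ (Op₂ A) (TwoSpace.PlusSpec T) × Σ (Op₂ A) (TwoSpace.TimesSpec T) ×
    (∀ (_+_ _·_ : Op₂ A) → TwoSpace.PlusSpec T _+_ → TwoSpace.TimesSpec T _·_ →
    IsDistributiveBisemilattice (TwoSpace._≈*_ T) _+_ _·_)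
lemma6p2 em T = plus-exists T em , times-exists T , distributive-bisemilattice T
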